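{- The satisfiability problem for HyperCTL$^*$ formulas of the form $\exists\pi.(\exists\pi''.\psi'')\,\mathsf U\,(\exists\pi'.\psi')$, where $\psi'$ and $\psi''$ are quantifier-free, is decidable: there is an algorithm deciding, for such a formula $\varphi$, whether some $AP$-labeled tree $\mathcal T$ satisfies $\mathcal T\models\varphi$.
   Context: A tree is a partially ordered infinite set of nodes $S$ with a least element (root) such that each node's ancestors are totally ordered; $s'$ is the direct ancestor of $s$ if $s'<s$ with nothing strictly between. An $AP$-labeled tree has $L:S\to2^{AP}$. A path is an infinite sequence $s_0s_1\dots$ with $s_i$ the direct ancestor of $s_{i+1}$; $Paths(\mathcal T)$ are the paths from the root; $p[0,i]$ is the prefix up to $i$. HyperCTL$^*$ syntax: $\varphi ::= a_\pi\mid\neg\varphi\mid\varphi\vee\varphi\mid\mathsf X\varphi\mid\varphi\mathsf U\varphi\mid\exists\pi.\varphi$. Semantics under a path assignment $\Pi$ and position $i$: $a_\pi$ holds iff $a\in L(\Pi(\pi)[i])$; Boolean and $\mathsf X$ as usual; $\Pi,i\models\varphi_1\mathsf U\varphi_2$ iff there is $j\ge i$ with $\Pi,j\models\varphi_2$ and $\Pi,k\models\varphi_1$ for all $i\le k<j$; $\Pi,i\models\exists\pi.\varphi$ iff some $p\in Paths(\mathcal T)$ with $p[0,i]=\Pi(\varepsilon)[0,i]$ ($\varepsilon$ the most recently quantified path; no constraint if none) satisfies $\Pi[\pi\mapsto p,\varepsilon\mapsto p],i\models\varphi$; $\mathcal T\models\varphi$ iff $\emptyset,0\models\varphi$. -}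

module Defs where

open import Data.Nat using (ℕ; zero; suc; _≤_; _<_)
open import Data.Nat.Properties using (_≟_)
open import Data.Bool using (Bool; true)
open import Data.Fin using (Fin)
open import Data.Maybe using (Maybe; just; nothing)
open import Data.Product using (Σ; _×_; ∃-syntax)
open import Data.Sum using (_⊎_)
open import Data.Empty using (⊥)
open import Data.Unit using (⊤)
open import Relation.Nullary using (¬_; yes; no)
open import Relation.Binary using (Rel; IsStrictPartialOrder)
open import Relation.Binary.PropositionalEquality using (_≡_)
open import Function.Bundles using (Injection)
open import Relation.Binary.PropositionalEquality using (setoid)

-- Atomic propositions: AP = ℕ (a formula uses finitely many of them).
AP : Set
AP = ℕ

Var : Set
Var = ℕ

record Tree : Set₁ where
  field
    Node       : Set
    _≺_        : Rel Node _          -- s' ≺ s : s' is a (strict) ancestor of s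
    isSPO      : IsStrictPartialOrder _≡_ _≺_
    root       : Node
    root-least : ∀ s → root ≡ s ⊎ root ≺ s
    anc-total  : ∀ s a b → a ≺ s → b ≺ s → a ≺ b ⊎ a ≡ b ⊎ b ≺ a
    infinite   : Injection (setoid ℕ) (setoid Node)
    label      : Node → AP → Bool   -- L : S → 2^AP (as characteristic functions)

  DirectAnc : Node → Node → Set
  DirectAnc s' s = s' ≺ s × (∀ t → ¬ (s' ≺ t × t ≺ s))

  record Path : Set where
    field
      at    : ℕ → Node
      start : at 0 ≡ root
      step  : ∀ i → DirectAnc (at i) (at (suc i))

open Tree public


data Formula : Set where
  atom   : AP → Var → Formula
  ¬'_    : Formula → Formula
  _∨'_   : Formula → Formula → Formula
  X'_    : Formula → Formula
  _U'_   : Formula → Formula → Formula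
  ∃'     : Var → Formula → Formula

module _ (T : Tree) where

  Assignment : Set
  Assignment = Var → Maybe (Path T)

  update : Assignment → Var → Path T → Assignment
  update Π π p x with x ≟ π
  ... | yes _ = just p
  ... | no  _ = Π x

  SamePrefix : Path T → Path T → ℕ → Set
  SamePrefix p q i = ∀ k → k ≤ i → Tree.Path.at p k ≡ Tree.Path.at q k

  PrefixOK : Maybe (Path T) → Path T → ℕ → Set
  PrefixOK nothing  p i = ⊤
  PrefixOK (just q) p i = SamePrefix p q i

  HoldsAt : Maybe (Path T) → AP → ℕ → Set
  HoldsAt nothing  a i = ⊥
  HoldsAt (just p) a i = label T (Tree.Path.at p i) a ≡ true

  -- Π , ε , i ⊨ φ   (ε = most recently quantified path, if any)
  Sem : Assignment → Maybe (Path T) → ℕ → Formula → Set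
  Sem Π ε i (atom a π) = HoldsAt (Π π) a i
  Sem Π ε i (¬' φ)     = ¬ Sem Π ε i φ
  Sem Π ε i (φ ∨' ψ)   = Sem Π ε i φ ⊎ Sem Π ε i ψ
  Sem Π ε i (X' φ)     = Sem Π ε (suc i) φ
  Sem Π ε i (φ U' ψ)   =
    ∃[ j ] (i ≤ j × Sem Π ε j ψ × (∀ k → i ≤ k → k < j → Sem Π ε k φ))
  Sem Π ε i (∃' π φ)   =
    ∃[ p ] (PrefixOK ε p i × Sem (update Π π p) (just p) i φ)

  _⊨_ : Formula → Set
  _⊨_ φ = Sem (λ _ → nothing) nothing 0 φ

Satisfiable : Formula → Set₁
Satisfiable φ = Σ Tree λ T → _⊨_ T φ

data QF (V : Set) : Set where
  atom : AP → V → QF V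
  ¬'_  : QF V → QF V
  _∨'_ : QF V → QF V → QF V
  X'_  : QF V → QF V
  _U'_ : QF V → QF V → QF V

embedQF : {V : Set} → (V → Var) → QF V → Formula
embedQF r (atom a v) = atom a (r v)
embedQF r (¬' φ)     = ¬' embedQF r φ
embedQF r (φ ∨' ψ)   = embedQF r φ ∨' embedQF r ψ
embedQF r (X' φ)     = X' embedQF r φ
embedQF r (φ U' ψ)   = embedQF r φ U' embedQF r ψ

-- Variable names: π = 0, π'' = 1, π' = 2.
-- In ψ'' the path variables in scope are π (Fin index 0) and π'' (index 1);
-- in ψ'  they are π (index 0) and π' (index 1).
varπ varπ'' varπ' : Var
varπ   = 0
varπ'' = 1
varπ'  = 2

ren : Var → Fin 2 → Var
ren other Fin.zero       = varπ
ren other (Fin.suc _)    = other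

fragment : (ψ'' ψ' : QF (Fin 2)) → Formula
fragment ψ'' ψ' =
  ∃' varπ ((∃' varπ'' (embedQF (ren varπ'') ψ''))
           U' (∃' varπ' (embedQF (ren varπ') ψ')))

-- In a model, the paths for π and π' that witness
-- ∃π'.ψ' at position j agree up to j, so their suffixes from j are such traces; conversely, two
-- such traces label the branches of a comb-shaped tree, in which the until is fulfilled at once.
--
-- Whether ψ' holds of some pair of traces is decided by the LTL tableau. Guess at every position a
-- truth value for each X- and U-subformula; letters restricted to the atoms of ψ' together with
-- guesses form the vertices of a finite graph whose edges are the locally consistent steps. A
-- lasso from an initial vertex whose cycle fulfils every eventuality unrolls to a model.
-- Conversely, sample the true guesses of a model at more points than there are vertices, each
-- point followed by a window in which every until is settled: a vertex repeats and closes a fair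
-- lasso. That direction is classical and only refutes the absence of a lasso, which suffices
-- because the existence of a lasso is decidable.

module Submission where

open import Defs
open import Data.Bool using (Bool; true; false; T; not; _∧_; _∨_)
open import Data.Bool.Properties using (T-≡; T-∧; T-∨) renaming (_≟_ to _≟ᵇ_)
open import Data.Empty using (⊥; ⊥-elim)
open import Data.Fin using (Fin; zero; suc; toℕ)
open import Data.Fin.Properties using (1↔⊤; 2↔Bool; *↔×; injective⇒≤; pigeonhole; toℕ<n)
import Data.Fin.Properties as Fin
open import Data.List using (List; []; _∷_; length; lookup; map; _++_)
open import Data.List.Membership.Propositional using (_∈_)
open import Data.List.Membership.Propositional.Properties using (∈-lookup)
import Data.List.Membership.DecPropositional as DecMembership
open import Data.List.Relation.Unary.All using (All; []; _∷_; all?)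
import Data.List.Relation.Unary.All as All
open import Data.List.Relation.Unary.All.Properties using (¬Any⇒All¬; ++⁻; map⁻; ++⁺; map⁺)
open import Data.List.Relation.Unary.Any using (here; there)
open import Data.List.Relation.Unary.Unique.Propositional using (Unique)
open import Data.List.Relation.Unary.AllPairs using ([]; _∷_)
open import Data.Maybe using (just; nothing)
open import Data.Nat
  using (ℕ; zero; suc; _+_; _∸_; _⊔_; _≤_; _<_; _≤‴_; ≤‴-refl; ≤‴-step; z≤n; s≤s)
open import Data.Nat.Properties
  using (_≟_; ≤-refl; ≤-trans; <⇒≤; <-≤-trans; <-trans; <-irrefl; <-cmp; ≤-pred; ≤⇒≯;
         ≤∧≢⇒<; m≤n⇒m<n∨m≡n; n≤1+n; n<1+n; ≤‴⇒≤; ≤⇒≤‴; m≤m⊔n; m≤n⊔m; m≤n+m;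
         m∸n+n≡m; m+n∸n≡m; +-monoˡ-≤; +-monoˡ-<; +-cancelʳ-<; ∸-monoˡ-≤)
open import Data.Product using (Σ; Σ-syntax; ∃-syntax; _×_; _,_; proj₁; proj₂)
import Data.Product as Product
open import Data.Product.Function.NonDependent.Propositional using (_×-⇔_; _×-↔_)
open import Data.Sum using (_⊎_; inj₁; inj₂; [_,_])
open import Data.Sum.Function.Propositional using (_⊎-⇔_)
open import Data.Unit using (⊤; tt)
open import Data.Vec using (Vec; []; _∷_)
open import Data.Vec.Properties using (≡-dec)
open import Effect.Monad using (RawMonad)
open import Function using (_∘_)
open import Function.Bundles using (_⇔_; _↔_; mk⇔; Equivalence; Inverse; mk↔ₛ′)
open import Function.Definitions using (Injective)
open import Function.Properties.Equivalence
  using () renaming (refl to ⇔-refl; sym to ⇔-sym; trans to ⇔-trans)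
open import Function.Properties.Inverse using (↔-sym; ↔-trans)
open import Function.Related.TypeIsomorphisms using (¬-cong-⇔)
open import Level using (0ℓ)
open import Relation.Binary using (Rel; Decidable; DecidableEquality; _⇒_; tri<; tri≈; tri>)
open import Relation.Binary.Construct.Closure.ReflexiveTransitive using (Star; ε; _◅_; _◅◅_)
open import Relation.Binary.PropositionalEquality
  using (_≡_; refl; sym; cong; cong₂; subst; isEquivalence; resp₂; module ≡-Reasoning)
open import Relation.Nullary using (¬_; Dec; yes; no; contradiction)
open import Relation.Nullary.Decidable
  using (_×-dec_; _⊎-dec_; map′; decidable-stable; T?; isYes; toWitness; fromWitness;
         ¬¬-excluded-middle)
open import Relation.Nullary.Negation using (¬¬-Monad)
open import Relation.Unary using (Pred)

open Equivalence using (to; from)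
open RawMonad (¬¬-Monad {0ℓ}) using (pure; _>>=_)

-- Until over ℕ

Until : (ℕ → Set) → (ℕ → Set) → ℕ → Set
Until P Q i = ∃[ j ] (i ≤ j × Q j × (∀ k → i ≤ k → k < j → P k))

InfinitelyOften : (ℕ → Set) → Set
InfinitelyOften P = ∀ k → ∃[ j ] (k ≤ j × P j)

module _ {P Q : ℕ → Set} where

  Until-here : ∀ {i} → Q i → Until P Q i
  Until-here {i} q = i , ≤-refl , q , λ k i≤k k<i → contradiction k<i (≤⇒≯ i≤k)

  Until-step : ∀ {i} → P i → Until P Q (suc i) → Until P Q i
  Until-step {i} p (j , i<j , q , ps) = j , <⇒≤ i<j , q , before
    where
      before : ∀ k → i ≤ k → k < j → P k
      before k i≤k k<j with m≤n⇒m<n∨m≡n i≤k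
      ... | inj₁ i<k  = ps k i<k k<j
      ... | inj₂ refl = p

  Until-unfold : ∀ {i} → Until P Q i ⇔ (Q i ⊎ (P i × Until P Q (suc i)))
  Until-unfold {i} = mk⇔ unfold [ Until-here , (λ (p , u) → Until-step p u) ]
    where
      unfold : Until P Q i → Q i ⊎ (P i × Until P Q (suc i))
      unfold (j , i≤j , q , ps) with m≤n⇒m<n∨m≡n i≤j
      ... | inj₁ i<j  = inj₂ (ps i ≤-refl i<j , j , i<j , q , λ k i<k → ps k (<⇒≤ i<k))
      ... | inj₂ refl = inj₁ q

  Until-least : {B : ℕ → Set} → (∀ {k} → Q k ⊎ (P k × B (suc k)) → B k) →
                ∀ {i} → Until P Q i → B i
  Until-least {B} closed (j , i≤j , q , ps) = go (≤⇒≤‴ i≤j) ps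
    where
      go : ∀ {i} → i ≤‴ j → (∀ k → i ≤ k → k < j → P k) → B i
      go ≤‴-refl _ = closed (inj₁ q)
      go (≤‴-step i<j) ps =
        closed (inj₂ (ps _ ≤-refl (≤‴⇒≤ i<j) , go i<j (λ k i<k → ps k (<⇒≤ i<k))))

  Until-greatest : {B : ℕ → Set} → (∀ {k} → B k → Q k ⊎ (P k × B (suc k))) →
                   InfinitelyOften (λ j → Q j ⊎ ¬ B j) → ∀ {i} → B i → Until P Q i
  Until-greatest {B} unfold fair {i} b with fair i
  ... | j , i≤j , settled = go (≤⇒≤‴ i≤j) b
    where
      go : ∀ {k} → k ≤‴ j → B k → Until P Q k
      go ≤‴-refl b = [ Until-here , contradiction b ] settled
      go (≤‴-step k<j) b = [ Until-here , (λ (p , b′) → Until-step p (go k<j b′)) ] (unfold b)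

Until-map : ∀ {P Q P′ Q′ : ℕ → Set} → (∀ {k} → P k → P′ k) → (∀ {k} → Q k → Q′ k) →
            ∀ {i} → Until P Q i → Until P′ Q′ i
Until-map f g (j , i≤j , q , ps) = j , i≤j , g q , λ k i≤k k<j → f (ps k i≤k k<j)

Until-cong : ∀ {P Q P′ Q′ : ℕ → Set} → (∀ k → P k ⇔ P′ k) → (∀ k → Q k ⇔ Q′ k) →
             ∀ i → Until P Q i ⇔ Until P′ Q′ i
Until-cong P⇔ Q⇔ i =
  mk⇔ (Until-map (to (P⇔ _)) (to (Q⇔ _))) (Until-map (from (P⇔ _)) (from (Q⇔ _)))

Until-shift : ∀ {P Q : ℕ → Set} j i → Until (P ∘ (_+ j)) (Q ∘ (_+ j)) i ⇔ Until P Q (i + j)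
Until-shift {P} {Q} j i = mk⇔ shift unshift
  where
    above : ∀ {i k} → i + j ≤ k → ∃[ l ] (i ≤ l × k ≡ l + j)
    above {i} {k} i+j≤k =
      k ∸ j , subst (_≤ k ∸ j) (m+n∸n≡m i j) (∸-monoˡ-≤ j i+j≤k) ,
      sym (m∸n+n≡m (≤-trans (m≤n+m j i) i+j≤k))
    shift : Until (P ∘ (_+ j)) (Q ∘ (_+ j)) i → Until P Q (i + j)
    shift (m , i≤m , q , ps) = m + j , +-monoˡ-≤ j i≤m , q , before
      where
        before : ∀ k → i + j ≤ k → k < m + j → P k
        before k i+j≤k k<m+j with above i+j≤k
        ... | l , i≤l , refl = ps l i≤l (+-cancelʳ-< j l m k<m+j)
    unshift : Until P Q (i + j) → Until (P ∘ (_+ j)) (Q ∘ (_+ j)) i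
    unshift (m , i+j≤m , q , ps) with above i+j≤m
    ... | l , i≤l , refl =
      l , i≤l , q , λ k i≤k k<l → ps (k + j) (+-monoˡ-≤ j i≤k) (+-monoˡ-< j k<l)

-- Pairs of traces and comb-shaped trees

Letter : Set
Letter = Fin 2 → AP → Bool

Trace : Set
Trace = ℕ → Letter

Holds : Trace → ℕ → QF (Fin 2) → Set
Holds w i (atom a v) = T (w i v a)
Holds w i (¬' φ)     = ¬ Holds w i φ
Holds w i (φ ∨' ψ)   = Holds w i φ ⊎ Holds w i ψ
Holds w i (X' φ)     = Holds w (suc i) φ
Holds w i (φ U' ψ)   = Until (λ k → Holds w k φ) (λ k → Holds w k ψ) i

Holds-shift : ∀ w j i φ → Holds (λ k → w (k + j)) i φ ⇔ Holds w (i + j) φ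
Holds-shift w j i (atom a v) = ⇔-refl
Holds-shift w j i (¬' φ)     = ¬-cong-⇔ (Holds-shift w j i φ)
Holds-shift w j i (φ ∨' ψ)   = Holds-shift w j i φ ⊎-⇔ Holds-shift w j i ψ
Holds-shift w j i (X' φ)     = Holds-shift w j (suc i) φ
Holds-shift w j i (φ U' ψ)   =
  ⇔-trans (Until-cong (λ k → Holds-shift w j k φ) (λ k → Holds-shift w j k ψ) i) (Until-shift j i)

StartTogether : Trace → Set
StartTogether w = ∀ a → w 0 zero a ≡ w 0 (suc zero) a

TwoTraceModel : QF (Fin 2) → Set
TwoTraceModel ψ = Σ[ w ∈ Trace ] (StartTogether w × Holds w 0 ψ)

module _ (𝒯 : Tree) (Π : Assignment 𝒯) (r : Fin 2 → Var) (w : Trace)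
         (atoms : ∀ i v a → HoldsAt 𝒯 (Π (r v)) a i ⇔ T (w i v a)) where

  Sem-embedQF : ∀ recent i φ → Sem 𝒯 Π recent i (embedQF r φ) ⇔ Holds w i φ
  Sem-embedQF recent i (atom a v) = atoms i v a
  Sem-embedQF recent i (¬' φ)     = ¬-cong-⇔ (Sem-embedQF recent i φ)
  Sem-embedQF recent i (φ ∨' ψ)   = Sem-embedQF recent i φ ⊎-⇔ Sem-embedQF recent i ψ
  Sem-embedQF recent i (X' φ)     = Sem-embedQF recent (suc i) φ
  Sem-embedQF recent i (φ U' ψ)   =
    Until-cong (λ k → Sem-embedQF recent k φ) (λ k → Sem-embedQF recent k ψ) i

satisfiable⇒twoTraceModel : ∀ ψ'' ψ' → Satisfiable (fragment ψ'' ψ') → TwoTraceModel ψ'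
satisfiable⇒twoTraceModel ψ'' ψ' (𝒯 , p , _ , j , _ , (q , q≗p , holds) , _) =
  (λ k → w (k + j)) , startTogether ,
  from (Holds-shift w j 0 ψ') (to (Sem-embedQF 𝒯 Π (ren varπ') w atoms (just q) j ψ') holds)
  where
    path : Fin 2 → Path 𝒯
    path zero    = p
    path (suc _) = q
    w : Trace
    w i v = label 𝒯 (Path.at (path v) i)
    Π : Assignment 𝒯
    Π = update 𝒯 (update 𝒯 (λ _ → nothing) varπ p) varπ' q
    atoms : ∀ i v a → HoldsAt 𝒯 (Π (ren varπ' v)) a i ⇔ T (w i v a)
    atoms i zero       a = ⇔-sym T-≡
    atoms i (suc zero) a = ⇔-sym T-≡
    startTogether : StartTogether (λ k → w (k + j))
    startTogether a = cong (λ s → label 𝒯 s a) (sym (q≗p j ≤-refl))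

data CombNode : Set where
  origin : CombNode
  node   : Fin 2 → ℕ → CombNode

infix 4 _⊏_
_⊏_ : CombNode → CombNode → Set
origin   ⊏ origin   = ⊥
origin   ⊏ node _ _ = ⊤
node _ _ ⊏ origin   = ⊥
node u m ⊏ node v n = u ≡ v × m < n

⊏-irrefl : ∀ {s t} → s ≡ t → ¬ s ⊏ t
⊏-irrefl {node _ _} refl (_ , m<m) = <-irrefl refl m<m

⊏-trans : ∀ {s t u} → s ⊏ t → t ⊏ u → s ⊏ u
⊏-trans {origin} {node _ _} {node _ _} _              _              = tt
⊏-trans {node _ _} {node _ _} {node _ _} (refl , l<m) (refl , m<n) = refl , <-trans l<m m<n

⊏-ancestors-total : ∀ s t u → t ⊏ s → u ⊏ s → t ⊏ u ⊎ t ≡ u ⊎ u ⊏ t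
⊏-ancestors-total _          origin     origin     _          _          = inj₂ (inj₁ refl)
⊏-ancestors-total _          origin     (node _ _) _          _          = inj₁ tt
⊏-ancestors-total _          (node _ _) origin     _          _          = inj₂ (inj₂ tt)
⊏-ancestors-total (node _ _) (node _ m) (node _ n) (refl , _) (refl , _) with <-cmp m n
... | tri< m<n _ _ = inj₁ (refl , m<n)
... | tri≈ _ refl _ = inj₂ (inj₁ refl)
... | tri> _ _ n<m = inj₂ (inj₂ (refl , n<m))

combTree : Trace → Tree
combTree w = record
  { Node       = CombNode
  ; _≺_        = _⊏_
  ; isSPO      = record
    { isEquivalence = isEquivalence
    ; irrefl        = ⊏-irrefl
    ; trans         = λ {s} {t} {u} → ⊏-trans {s} {t} {u}
    ; <-resp-≈      = resp₂ _⊏_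
    }
  ; root       = origin
  ; root-least = λ { origin → inj₁ refl ; (node _ _) → inj₂ tt }
  ; anc-total  = ⊏-ancestors-total
  ; infinite   = record
    { to        = node zero
    ; cong      = cong (node zero)
    ; injective = λ { refl → refl }
    }
  ; label      = λ { origin → w 0 zero ; (node v n) → w (suc n) v }
  }

branch : (w : Trace) → Fin 2 → Path (combTree w)
branch w v = record { at = at ; start = refl ; step = step }
  where
    at : ℕ → CombNode
    at zero    = origin
    at (suc n) = node v n
    step : ∀ i → DirectAnc (combTree w) (at i) (at (suc i))
    step zero    = tt , λ { origin (() , _) ; (node _ _) (_ , ()) }
    step (suc i) = (refl , ≤-refl) , λ
      { origin (() , _)
      ; (node _ m) ((refl , i<m) , (refl , m<1+i)) → <-irrefl refl (<-≤-trans i<m (≤-pred m<1+i)) }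

twoTraceModel⇒satisfiable : ∀ ψ'' ψ' → TwoTraceModel ψ' → Satisfiable (fragment ψ'' ψ')
twoTraceModel⇒satisfiable ψ'' ψ' (w , startTogether , holds) =
  combTree w , branch w zero , tt ,
  0 , z≤n , (branch w (suc zero) , (λ { zero _ → refl }) , from Sem⇔Holds holds) , λ _ _ ()
  where
    Π : Assignment (combTree w)
    Π = update _ (update _ (λ _ → nothing) varπ (branch w zero)) varπ' (branch w (suc zero))
    atoms : ∀ i v a → HoldsAt (combTree w) (Π (ren varπ' v)) a i ⇔ T (w i v a)
    atoms zero    zero       a = ⇔-sym T-≡
    atoms zero    (suc zero) a =
      subst (λ b → (w 0 zero a ≡ true) ⇔ T b) (startTogether a) (⇔-sym T-≡)
    atoms (suc i) zero       a = ⇔-sym T-≡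
    atoms (suc i) (suc zero) a = ⇔-sym T-≡
    Sem⇔Holds = Sem-embedQF (combTree w) Π (ren varπ') w atoms (just (branch w (suc zero))) 0 ψ'

-- Finite types and reachability in finite graphs

Finite : Set → Set
Finite A = ∃[ n ] (A ↔ Fin n)

module _ {A : Set} (finite : Finite A) where

  private
    module A↔Fin = Inverse (proj₂ finite)

  encode : A → Fin (proj₁ finite)
  encode = A↔Fin.to

  encode-injective : Injective _≡_ _≡_ encode
  encode-injective {x} {y} eq = begin
    x                      ≡⟨ A↔Fin.strictlyInverseʳ x ⟨
    A↔Fin.from (encode x)  ≡⟨ cong A↔Fin.from eq ⟩
    A↔Fin.from (encode y)  ≡⟨ A↔Fin.strictlyInverseʳ y ⟩
    y                      ∎
    where open ≡-Reasoning

  Finite⇒≟ : DecidableEquality A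
  Finite⇒≟ x y = map′ encode-injective (cong encode) (encode x Fin.≟ encode y)

  Finite⇒any? : {P : Pred A 0ℓ} → (∀ x → Dec (P x)) → Dec (∃[ x ] P x)
  Finite⇒any? {P} P? =
    map′ (λ (i , p) → A↔Fin.from i , p)
         (λ (x , p) → encode x , subst P (sym (A↔Fin.strictlyInverseʳ x)) p)
         (Fin.any? (P? ∘ A↔Fin.from))

Finite-⊤ : Finite ⊤
Finite-⊤ = 1 , ↔-sym 1↔⊤

Finite-Bool : Finite Bool
Finite-Bool = 2 , ↔-sym 2↔Bool

Finite-× : ∀ {A B} → Finite A → Finite B → Finite (A × B)
Finite-× (m , A↔m) (n , B↔n) = _ , ↔-trans (A↔m ×-↔ B↔n) (↔-sym (*↔× {m} {n}))

Finite-Vec : ∀ {A} → Finite A → ∀ n → Finite (Vec A n)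
Finite-Vec finite zero    = _ , ↔-trans Vec0↔⊤ (proj₂ Finite-⊤)
  where
    Vec0↔⊤ : Vec _ 0 ↔ ⊤
    Vec0↔⊤ = mk↔ₛ′ _ (λ _ → []) (λ _ → refl) (λ { [] → refl })
Finite-Vec {A} finite (suc n) =
  _ , ↔-trans Vec[1+n]↔× (proj₂ (Finite-× finite (Finite-Vec finite n)))
  where
    Vec[1+n]↔× : Vec A (suc n) ↔ (A × Vec A n)
    Vec[1+n]↔× =
      mk↔ₛ′ (λ { (x ∷ xs) → x , xs }) (λ (x , xs) → x ∷ xs) (λ _ → refl) (λ { (_ ∷ _) → refl })

lookup-injective : ∀ {A : Set} {xs : List A} → Unique xs → Injective _≡_ _≡_ (lookup xs)
lookup-injective (_    ∷ _) {zero}  {zero}  _  = refl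
lookup-injective (x∉xs ∷ _) {zero}  {suc j} eq = contradiction eq (All.lookup x∉xs (∈-lookup j))
lookup-injective (x∉xs ∷ _) {suc i} {zero}  eq = contradiction (sym eq) (All.lookup x∉xs (∈-lookup i))
lookup-injective (_    ∷ u) {suc i} {suc j} eq = cong suc (lookup-injective u eq)

Unique⇒length≤ : ∀ {A} (finite : Finite A) {xs : List A} → Unique xs → length xs ≤ proj₁ finite
Unique⇒length≤ finite u = injective⇒≤ (λ eq → lookup-injective u (encode-injective finite eq))

module _ {A : Set} {E : Rel A 0ℓ} where

  Visits : Pred A 0ℓ → ∀ {x y} → Star E x y → Set
  Visits P {x} ε       = P x
  Visits P {x} (_ ◅ p) = P x ⊎ Visits P p

  Visits-start : ∀ {P x y} → P x → (p : Star E x y) → Visits P p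
  Visits-start px ε       = px
  Visits-start px (_ ◅ _) = inj₁ px

  Visits-◅◅ : ∀ {P x y z} (p : Star E x y) {q : Star E y z} → Visits P q → Visits P (p ◅◅ q)
  Visits-◅◅ ε       v = v
  Visits-◅◅ (_ ◅ p) v = inj₂ (Visits-◅◅ p v)

module _ {A : Set} {E : Rel A 0ℓ} (x : ℕ → A) {n}
         (step : ∀ k → k < n → E (x k) (x (suc k))) where

  Star-sequence : ∀ {i j} → i ≤ j → j ≤ n → Star E (x i) (x j)
  Star-sequence {j = j} i≤j j≤n = go (≤⇒≤‴ i≤j)
    where
      go : ∀ {i} → i ≤‴ j → Star E (x i) (x j)
      go ≤‴-refl       = ε
      go (≤‴-step i<j) = step _ (<-≤-trans (≤‴⇒≤ i<j) j≤n) ◅ go i<j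

module FiniteGraph {A : Set} (finite : Finite A) {E : Rel A 0ℓ} (E? : Decidable E) where

  open DecMembership (Finite⇒≟ finite) using (_∈?_)

  ReachWithin : ℕ → Rel A 0ℓ
  ReachWithin zero    x y = x ≡ y
  ReachWithin (suc n) x y = x ≡ y ⊎ ∃[ z ] (E x z × ReachWithin n z y)

  reachWithin? : ∀ n → Decidable (ReachWithin n)
  reachWithin? zero    x y = Finite⇒≟ finite x y
  reachWithin? (suc n) x y =
    Finite⇒≟ finite x y ⊎-dec Finite⇒any? finite (λ z → E? x z ×-dec reachWithin? n z y)

  ReachWithin⇒Star : ∀ n → ReachWithin n ⇒ Star E
  ReachWithin⇒Star zero    refl                = ε
  ReachWithin⇒Star (suc n) (inj₁ refl)         = ε
  ReachWithin⇒Star (suc n) (inj₂ (_ , e , r)) = e ◅ ReachWithin⇒Star n r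

  vertices : ∀ {x y} → Star E x y → List A
  vertices {x} ε       = x ∷ []
  vertices {x} (_ ◅ p) = x ∷ vertices p

  Star⇒ReachWithin : ∀ n {x y} (p : Star E x y) → length (vertices p) ≤ suc n →
                     ReachWithin n x y
  Star⇒ReachWithin zero    ε           _       = refl
  Star⇒ReachWithin zero    (_ ◅ ε)     (s≤s ())
  Star⇒ReachWithin zero    (_ ◅ _ ◅ _) (s≤s ())
  Star⇒ReachWithin (suc n) ε           _       = inj₁ refl
  Star⇒ReachWithin (suc n) (e ◅ p)     (s≤s ≤) = inj₂ (_ , e , Star⇒ReachWithin n p ≤)

  SimpleStar : Rel A 0ℓ
  SimpleStar x y = Σ[ p ∈ Star E x y ] Unique (vertices p)

  suffixFrom : ∀ {x y z} (p : Star E z y) → Unique (vertices p) → x ∈ vertices p → SimpleStar x y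
  suffixFrom ε       u       (here refl) = ε , u
  suffixFrom (e ◅ p) u       (here refl) = e ◅ p , u
  suffixFrom (e ◅ p) (_ ∷ u) (there x∈) = suffixFrom p u x∈

  simplify : ∀ {x y} → Star E x y → SimpleStar x y
  simplify {x} ε = ε , [] ∷ []
  simplify {x} (e ◅ p) with simplify p
  ... | q , u with x ∈? vertices q
  ... | yes x∈ = suffixFrom q u x∈
  ... | no x∉ = e ◅ q , ¬Any⇒All¬ _ x∉ ∷ u

  Reach : Rel A 0ℓ
  Reach = ReachWithin (proj₁ finite)

  reach? : Decidable Reach
  reach? = reachWithin? (proj₁ finite)

  Reach⇒Star : Reach ⇒ Star E
  Reach⇒Star = ReachWithin⇒Star (proj₁ finite)

  Star⇒Reach : Star E ⇒ Reach
  Star⇒Reach p with simplify p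
  ... | q , u = Star⇒ReachWithin _ q (≤-trans (Unique⇒length≤ finite u) (n≤1+n _))

  closedWalkThrough : ∀ {I : Set} {P : I → Pred A 0ℓ} {v} (qs : List I) →
                      All (λ q → ∃[ x ] (P q x × Reach v x × Reach x v)) qs →
                      Σ[ c ∈ Star E v v ] All (λ q → Visits (P q) c) qs
  closedWalkThrough []       []                          = ε , []
  closedWalkThrough (q ∷ qs) ((x , px , v⇝x , x⇝v) ∷ ws) =
    out ◅◅ back ◅◅ c ,
    Visits-◅◅ out (Visits-start px (back ◅◅ c)) ∷ All.map (Visits-◅◅ out ∘ Visits-◅◅ back) vs
    where
      out  = Reach⇒Star v⇝x
      back = Reach⇒Star x⇝v
      c  = proj₁ (closedWalkThrough qs ws)
      vs = proj₂ (closedWalkThrough qs ws)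

module LassoRun {A : Set} {E : Rel A 0ℓ} {x₀ x y : A}
                (stem : Star E x₀ x) (e : E x y) (loop : Star E y x) where

  Position : Set
  Position = Σ[ z ∈ A ] Star E z x

  next : Position → Position
  next (_ , _ ◅ p) = _ , p
  next (_ , ε)     = y , loop

  run : ℕ → Position
  run zero    = x₀ , stem
  run (suc k) = next (run k)

  vertexAt : ℕ → A
  vertexAt = proj₁ ∘ run

  run-step : ∀ k → E (vertexAt k) (vertexAt (suc k))
  run-step k = step (run k)
    where
      step : (s : Position) → E (proj₁ s) (proj₁ (next s))
      step (_ , e′ ◅ _) = e′
      step (_ , ε)      = e

  reaches-loop : ∀ k {z} (p : Star E z x) → run k ≡ (z , p) → ∃[ j ] (k ≤ j × run j ≡ (x , ε))
  reaches-loop k ε       eq = k , ≤-refl , eq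
  reaches-loop k (_ ◅ p) eq =
    Product.map₂ (Product.map₁ <⇒≤) (reaches-loop (suc k) p (cong next eq))

  visits : ∀ {P} k {z} (p : Star E z x) → run k ≡ (z , p) → Visits P p →
           ∃[ j ] (k ≤ j × P (vertexAt j))
  visits {P} k ε       eq pz        = k , ≤-refl , subst P (cong proj₁ (sym eq)) pz
  visits {P} k (_ ◅ p) eq (inj₁ pz) = k , ≤-refl , subst P (cong proj₁ (sym eq)) pz
  visits {P} k (_ ◅ p) eq (inj₂ v)  =
    Product.map₂ (Product.map₁ <⇒≤) (visits (suc k) p (cong next eq) v)

  visits-cycle : ∀ {P} j → run j ≡ (x , ε) → Visits P (e ◅ loop) →
                 ∃[ i ] (j ≤ i × P (vertexAt i))
  visits-cycle {P} j eq (inj₁ px) = j , ≤-refl , subst P (cong proj₁ (sym eq)) px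
  visits-cycle {P} j eq (inj₂ v)  =
    Product.map₂ (Product.map₁ <⇒≤) (visits (suc j) loop (cong next eq) v)

  run-visits : ∀ {P} → Visits P (e ◅ loop) → InfinitelyOften (P ∘ vertexAt)
  run-visits v k with reaches-loop k (proj₂ (run k)) refl
  ... | j , k≤j , eq = Product.map₂ (Product.map₁ (≤-trans k≤j)) (visits-cycle j eq v)

-- The tableau

T-not : ∀ {b} → T (not b) ⇔ (¬ T b)
T-not {false} = mk⇔ (λ _ ()) (λ _ → tt)
T-not {true}  = mk⇔ (λ ()) (λ ¬t → ¬t tt)

T-⇔⇒≡ : ∀ {a b} → T a ⇔ T b → a ≡ b
T-⇔⇒≡ {false} {false} _  = refl
T-⇔⇒≡ {false} {true}  a⇔b = ⊥-elim (from a⇔b tt)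
T-⇔⇒≡ {true}  {false} a⇔b = ⊥-elim (to a⇔b tt)
T-⇔⇒≡ {true}  {true}  _  = refl

Annotation : QF (Fin 2) → Set
Annotation (atom _ _) = ⊤
Annotation (¬' φ)     = Annotation φ
Annotation (φ ∨' ψ)   = Annotation φ × Annotation ψ
Annotation (X' φ)     = Bool × Annotation φ
Annotation (φ U' ψ)   = Bool × Annotation φ × Annotation ψ

Finite-Annotation : ∀ φ → Finite (Annotation φ)
Finite-Annotation (atom _ _) = Finite-⊤
Finite-Annotation (¬' φ)     = Finite-Annotation φ
Finite-Annotation (φ ∨' ψ)   = Finite-× (Finite-Annotation φ) (Finite-Annotation ψ)
Finite-Annotation (X' φ)     = Finite-× Finite-Bool (Finite-Annotation φ)
Finite-Annotation (φ U' ψ)   =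
  Finite-× Finite-Bool (Finite-× (Finite-Annotation φ) (Finite-Annotation ψ))

value : ∀ φ → Letter → Annotation φ → Bool
value (atom a v) ℓ _       = ℓ v a
value (¬' φ)     ℓ t       = not (value φ ℓ t)
value (φ ∨' ψ)   ℓ (t , u) = value φ ℓ t ∨ value ψ ℓ u
value (X' φ)     ℓ (b , _) = b
value (φ U' ψ)   ℓ (b , _) = b

Consistent : ∀ φ → Letter → Annotation φ → Letter → Annotation φ → Set
Consistent (atom _ _) _ _           _  _              = ⊤
Consistent (¬' φ)     ℓ t           ℓ′ t′             = Consistent φ ℓ t ℓ′ t′
Consistent (φ ∨' ψ)   ℓ (t , u)     ℓ′ (t′ , u′)      =
  Consistent φ ℓ t ℓ′ t′ × Consistent ψ ℓ u ℓ′ u′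
Consistent (X' φ)     ℓ (b , t)     ℓ′ (_ , t′)       =
  b ≡ value φ ℓ′ t′ × Consistent φ ℓ t ℓ′ t′
Consistent (φ U' ψ)   ℓ (b , t , u) ℓ′ (b′ , t′ , u′) =
  b ≡ (value ψ ℓ u ∨ (value φ ℓ t ∧ b′)) × Consistent φ ℓ t ℓ′ t′ × Consistent ψ ℓ u ℓ′ u′

consistent? : ∀ φ ℓ t ℓ′ t′ → Dec (Consistent φ ℓ t ℓ′ t′)
consistent? (atom _ _) _ _           _  _              = yes tt
consistent? (¬' φ)     ℓ t           ℓ′ t′             = consistent? φ ℓ t ℓ′ t′
consistent? (φ ∨' ψ)   ℓ (t , u)     ℓ′ (t′ , u′)      =
  consistent? φ ℓ t ℓ′ t′ ×-dec consistent? ψ ℓ u ℓ′ u′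
consistent? (X' φ)     ℓ (b , t)     ℓ′ (_ , t′)       =
  b ≟ᵇ value φ ℓ′ t′ ×-dec consistent? φ ℓ t ℓ′ t′
consistent? (φ U' ψ)   ℓ (b , t , u) ℓ′ (b′ , t′ , u′) =
  b ≟ᵇ (value ψ ℓ u ∨ (value φ ℓ t ∧ b′)) ×-dec
  consistent? φ ℓ t ℓ′ t′ ×-dec consistent? ψ ℓ u ℓ′ u′

-- Fairness asks each of these to hold infinitely often: an until guessed true is not postponed forever.
eventualities : ∀ φ → List (Letter → Annotation φ → Bool)
eventualities (atom _ _) = []
eventualities (¬' φ)     = eventualities φ
eventualities (φ ∨' ψ)   =
  map (λ q ℓ (t , _) → q ℓ t) (eventualities φ) ++ map (λ q ℓ (_ , u) → q ℓ u) (eventualities ψ)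
eventualities (X' φ)     = map (λ q ℓ (_ , t) → q ℓ t) (eventualities φ)
eventualities (φ U' ψ)   =
  (λ ℓ (b , _ , u) → value ψ ℓ u ∨ not b) ∷
  (map (λ q ℓ (_ , t , _) → q ℓ t) (eventualities φ) ++
   map (λ q ℓ (_ , _ , u) → q ℓ u) (eventualities ψ))

LocallyConsistent : ∀ φ → Trace → (ℕ → Annotation φ) → Set
LocallyConsistent φ w τ = ∀ k → Consistent φ (w k) (τ k) (w (suc k)) (τ (suc k))

Fair : ∀ φ → Trace → (ℕ → Annotation φ) → Set
Fair φ w τ = All (λ q → InfinitelyOften (λ k → T (q (w k) (τ k)))) (eventualities φ)

All-map-++⁻ : ∀ {A B C : Set} {P : Pred C 0ℓ} (f : A → C) (g : B → C) xs {ys} →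
              All P (map f xs ++ map g ys) → All (P ∘ f) xs × All (P ∘ g) ys
All-map-++⁻ f g xs = Product.map map⁻ map⁻ ∘ ++⁻ (map f xs)

value-sound : ∀ φ w (τ : ℕ → Annotation φ) → LocallyConsistent φ w τ → Fair φ w τ →
              ∀ k → T (value φ (w k) (τ k)) ⇔ Holds w k φ
value-sound (atom a v) w τ c f k = ⇔-refl
value-sound (¬' φ)     w τ c f k = ⇔-trans T-not (¬-cong-⇔ (value-sound φ w τ c f k))
value-sound (φ ∨' ψ)   w τ c f k =
  ⇔-trans T-∨ (value-sound φ w (proj₁ ∘ τ) (proj₁ ∘ c) fφ k ⊎-⇔
               value-sound ψ w (proj₂ ∘ τ) (proj₂ ∘ c) fψ k)
  where
    fφ = proj₁ (All-map-++⁻ _ _ (eventualities φ) f)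
    fψ = proj₂ (All-map-++⁻ _ _ (eventualities φ) f)
value-sound (X' φ)     w τ c f k =
  subst (λ b → T b ⇔ Holds w (suc k) φ) (sym (proj₁ (c k)))
        (value-sound φ w (proj₂ ∘ τ) (proj₂ ∘ c) (map⁻ f) (suc k))
value-sound (φ U' ψ)   w τ c (f ∷ fs) k =
  mk⇔ (Until-greatest (to unfold) fulfilled) (Until-least (from unfold))
  where
    b : ℕ → Bool
    b = proj₁ ∘ τ
    fφ = proj₁ (All-map-++⁻ _ _ (eventualities φ) fs)
    fψ = proj₂ (All-map-++⁻ _ _ (eventualities φ) fs)
    IHφ = value-sound φ w (proj₁ ∘ proj₂ ∘ τ) (proj₁ ∘ proj₂ ∘ c) fφ
    IHψ = value-sound ψ w (proj₂ ∘ proj₂ ∘ τ) (proj₂ ∘ proj₂ ∘ c) fψ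
    unfold : ∀ {k} → T (b k) ⇔ (Holds w k ψ ⊎ (Holds w k φ × T (b (suc k))))
    unfold {k} =
      subst (λ x → T x ⇔ (Holds w k ψ ⊎ (Holds w k φ × T (b (suc k))))) (sym (proj₁ (c k)))
            (⇔-trans T-∨ (IHψ k ⊎-⇔ ⇔-trans T-∧ (IHφ k ×-⇔ ⇔-refl)))
    fulfilled : InfinitelyOften (λ j → Holds w j ψ ⊎ ¬ T (b j))
    fulfilled k = Product.map₂ (Product.map₂ (to (⇔-trans T-∨ (IHψ _ ⊎-⇔ T-not)))) (f k)

AtomsBelow : ℕ → QF (Fin 2) → Set
AtomsBelow M (atom a _) = a < M
AtomsBelow M (¬' φ)     = AtomsBelow M φ
AtomsBelow M (φ ∨' ψ)   = AtomsBelow M φ × AtomsBelow M ψ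
AtomsBelow M (X' φ)     = AtomsBelow M φ
AtomsBelow M (φ U' ψ)   = AtomsBelow M φ × AtomsBelow M ψ

atomBound : QF (Fin 2) → ℕ
atomBound (atom a _) = suc a
atomBound (¬' φ)     = atomBound φ
atomBound (φ ∨' ψ)   = atomBound φ ⊔ atomBound ψ
atomBound (X' φ)     = atomBound φ
atomBound (φ U' ψ)   = atomBound φ ⊔ atomBound ψ

AtomsBelow-mono : ∀ {M N} φ → M ≤ N → AtomsBelow M φ → AtomsBelow N φ
AtomsBelow-mono (atom _ _) M≤N a<M       = <-≤-trans a<M M≤N
AtomsBelow-mono (¬' φ)     M≤N b         = AtomsBelow-mono φ M≤N b
AtomsBelow-mono (φ ∨' ψ)   M≤N (bφ , bψ) = AtomsBelow-mono φ M≤N bφ , AtomsBelow-mono ψ M≤N bψ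
AtomsBelow-mono (X' φ)     M≤N b         = AtomsBelow-mono φ M≤N b
AtomsBelow-mono (φ U' ψ)   M≤N (bφ , bψ) = AtomsBelow-mono φ M≤N bφ , AtomsBelow-mono ψ M≤N bψ

AtomsBelow-atomBound : ∀ φ → AtomsBelow (atomBound φ) φ
AtomsBelow-atomBound (atom _ _) = ≤-refl
AtomsBelow-atomBound (¬' φ)     = AtomsBelow-atomBound φ
AtomsBelow-atomBound (φ ∨' ψ)   =
  AtomsBelow-mono φ (m≤m⊔n _ _) (AtomsBelow-atomBound φ) ,
  AtomsBelow-mono ψ (m≤n⊔m _ _) (AtomsBelow-atomBound ψ)
AtomsBelow-atomBound (X' φ)     = AtomsBelow-atomBound φ
AtomsBelow-atomBound (φ U' ψ)   =
  AtomsBelow-mono φ (m≤m⊔n _ _) (AtomsBelow-atomBound φ) ,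
  AtomsBelow-mono ψ (m≤n⊔m _ _) (AtomsBelow-atomBound ψ)

Snapshot : ℕ → Set
Snapshot M = Vec Bool M × Vec Bool M

-- Atoms beyond the length of the vector read as false.
_!_ : ∀ {n} → Vec Bool n → AP → Bool
[]       ! _     = false
(b ∷ _)  ! zero  = b
(_ ∷ bs) ! suc a = bs ! a

prefix : (AP → Bool) → ∀ n → Vec Bool n
prefix f zero    = []
prefix f (suc n) = f 0 ∷ prefix (f ∘ suc) n

prefix-! : ∀ f {n a} → a < n → prefix f n ! a ≡ f a
prefix-! f {suc n} {zero}  _         = refl
prefix-! f {suc n} {suc a} (s≤s a<n) = prefix-! (f ∘ suc) a<n

prefix-cong : ∀ {f g} n → (∀ a → f a ≡ g a) → prefix f n ≡ prefix g n
prefix-cong zero    _   = refl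
prefix-cong (suc n) f≗g = cong₂ _∷_ (f≗g 0) (prefix-cong n (f≗g ∘ suc))

letter : ∀ {M} → Snapshot M → Letter
letter (s₀ , _) zero    = s₀ !_
letter (_ , s₁) (suc _) = s₁ !_

snapshot : ∀ M → Letter → Snapshot M
snapshot M ℓ = prefix (ℓ zero) M , prefix (ℓ (suc zero)) M

letter-snapshot : ∀ {M} ℓ v {a} → a < M → letter (snapshot M ℓ) v a ≡ ℓ v a
letter-snapshot ℓ zero       = prefix-! (ℓ zero)
letter-snapshot ℓ (suc zero) = prefix-! (ℓ (suc zero))

module Tableau (ψ : QF (Fin 2)) (M : ℕ) where

  Vertex : Set
  Vertex = Snapshot M × Annotation ψ

  Step : Rel Vertex 0ℓ
  Step (s , t) (s′ , t′) = Consistent ψ (letter s) t (letter s′) t′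

  Finite-Vertex : Finite Vertex
  Finite-Vertex =
    Finite-× (Finite-× (Finite-Vec Finite-Bool M) (Finite-Vec Finite-Bool M)) (Finite-Annotation ψ)

  step? : Decidable Step
  step? (s , t) (s′ , t′) = consistent? ψ (letter s) t (letter s′) t′

  open FiniteGraph Finite-Vertex step? public

  Initial : Vertex → Set
  Initial ((s₀ , s₁) , t) = s₀ ≡ s₁ × T (value ψ (letter (s₀ , s₁)) t)

  Fulfils : (Letter → Annotation ψ → Bool) → Vertex → Set
  Fulfils q (s , t) = T (q (letter s) t)

  FairLasso : Set
  FairLasso = ∃[ v₀ ] ∃[ v ] (Initial v₀ × Reach v₀ v × (∃[ u ] (Step v u × Reach u v)) ×
                              All (λ q → ∃[ x ] (Fulfils q x × Reach v x × Reach x v)) (eventualities ψ))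

  fairLasso? : Dec FairLasso
  fairLasso? =
    any? λ v₀ → any? λ v →
      initial? v₀ ×-dec reach? v₀ v ×-dec any? (λ u → step? v u ×-dec reach? u v) ×-dec
      all? (λ q → any? λ x → T? _ ×-dec reach? v x ×-dec reach? x v) (eventualities ψ)
    where
      any? = Finite⇒any? Finite-Vertex
      initial? : ∀ v → Dec (Initial v)
      initial? ((s₀ , s₁) , t) = ≡-dec _≟ᵇ_ s₀ s₁ ×-dec T? _

  fairLasso⇒twoTraceModel : FairLasso → TwoTraceModel ψ
  fairLasso⇒twoTraceModel (v₀ , v , (s₀≡s₁ , holds) , v₀⇝v , (u , e , u⇝v) , fulfilled) =
    w , (λ a → cong (_! a) s₀≡s₁) , to (value-sound ψ w τ run-step fair 0) holds
    where
      tour = closedWalkThrough (eventualities ψ) fulfilled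
      back = Reach⇒Star u⇝v
      open LassoRun (Reach⇒Star v₀⇝v) e (back ◅◅ proj₁ tour)
      w : Trace
      w = letter ∘ proj₁ ∘ vertexAt
      τ : ℕ → Annotation ψ
      τ = proj₂ ∘ vertexAt
      fair : Fair ψ w τ
      fair = All.map (λ visits-q → run-visits (inj₂ (Visits-◅◅ back visits-q))) (proj₂ tour)

-- Classical choices under double negation

¬¬-truthValue : ∀ {P : Set} → ¬ ¬ (Σ[ b ∈ Bool ] (T b ⇔ P))
¬¬-truthValue = do
  P? ← ¬¬-excluded-middle
  pure (isYes P? , mk⇔ toWitness fromWitness)

UpwardClosed : (ℕ → Set) → Set
UpwardClosed P = ∀ {j j′} → j ≤ j′ → P j → P j′

∃≥-× : ∀ {P Q : ℕ → Set} {i} → UpwardClosed P → UpwardClosed Q →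
       ∃[ j ] (i ≤ j × P j) → ∃[ j ] (i ≤ j × Q j) → ∃[ j ] (i ≤ j × P j × Q j)
∃≥-× P↑ Q↑ (j , i≤j , p) (j′ , _ , q) =
  j ⊔ j′ , ≤-trans i≤j (m≤m⊔n j j′) , P↑ (m≤m⊔n j j′) p , Q↑ (m≤n⊔m j j′) q

Chain : (ℕ → ℕ → Set) → ℕ → (ℕ → ℕ) → Set
Chain G n p = ∀ m → m < n → p m < p (suc m) × G (p m) (p (suc m))

Chain-< : ∀ {G n p m k} → Chain G n p → m < k → k ≤ n → p m < p k
Chain-< {p = p} {k = k} chain m<k k≤n = go (≤⇒≤‴ m<k)
  where
    go : ∀ {m} → suc m ≤‴ k → p m < p k
    go ≤‴-refl        = proj₁ (chain _ k≤n)
    go (≤‴-step m+1<k) =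
      <-trans (proj₁ (chain _ (≤-trans (≤‴⇒≤ (≤‴-step m+1<k)) k≤n))) (go m+1<k)

Chain-≤ : ∀ {G n p m k} → Chain G n p → m ≤ k → k ≤ n → p m ≤ p k
Chain-≤ {G} chain m≤k k≤n with m≤n⇒m<n∨m≡n m≤k
... | inj₁ m<k  = <⇒≤ (Chain-< {G} chain m<k k≤n)
... | inj₂ refl = ≤-refl

¬¬-chain : ∀ {G : ℕ → ℕ → Set} → (∀ {i} → UpwardClosed (G i)) →
           (∀ i → ¬ ¬ (∃[ j ] (i ≤ j × G i j))) →
           ∀ n i → ¬ ¬ (Σ[ p ∈ (ℕ → ℕ) ] (p 0 ≡ i × Chain G n p))
¬¬-chain G↑ G-ahead zero    i = pure ((λ _ → i) , refl , λ _ ())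
¬¬-chain {G} G↑ G-ahead (suc n) i = do
  (j , i≤j , g) ← G-ahead i
  (p , p0≡1+j , chain) ← ¬¬-chain G↑ G-ahead n (suc j)
  pure (prepend p , refl , λ
    { zero    _         → subst (i <_) (sym p0≡1+j) (s≤s i≤j) ,
                          subst (G i) (sym p0≡1+j) (G↑ (n≤1+n j) g)
    ; (suc m) (s≤s m<n) → chain m m<n })
  where
    prepend : (ℕ → ℕ) → ℕ → ℕ
    prepend p zero    = i
    prepend p (suc m) = p m

¬¬-bounded-choice : ∀ {A : Set} {P : ℕ → A → Set} → (∀ k → ¬ ¬ Σ A (P k)) →
                    ∀ n → ¬ ¬ (Σ[ f ∈ (ℕ → A) ] (∀ k → k ≤ n → P k (f k)))
¬¬-bounded-choice choose zero    = do
  (a , pa) ← choose 0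
  pure ((λ _ → a) , λ { zero z≤n → pa })
¬¬-bounded-choice {A} {P} choose (suc n) = do
  (f , pf) ← ¬¬-bounded-choice choose n
  (a , pa) ← choose (suc n)
  pure (extend f a , extend-satisfies pf pa)
  where
    extend : (ℕ → A) → A → ℕ → A
    extend f a k with k ≟ suc n
    ... | yes _ = a
    ... | no  _ = f k
    extend-satisfies : ∀ {f a} → (∀ k → k ≤ n → P k (f k)) → P (suc n) a →
                       ∀ k → k ≤ suc n → P k (extend f a k)
    extend-satisfies pf pa k k≤1+n with k ≟ suc n
    ... | yes refl = pa
    ... | no  k≢   = pf k (≤-pred (≤∧≢⇒< k≤1+n k≢))

-- Completeness of the tableau

module Completeness (w : Trace) (M : ℕ) where

  ℓ : ℕ → Letter
  ℓ k = letter (snapshot M (w k))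

  Truthful : ∀ φ → ℕ → Annotation φ → Set
  Truthful (atom _ _) k _           = ⊤
  Truthful (¬' φ)     k t           = Truthful φ k t
  Truthful (φ ∨' ψ)   k (t , u)     = Truthful φ k t × Truthful ψ k u
  Truthful (X' φ)     k (b , t)     = (T b ⇔ Holds w (suc k) φ) × Truthful φ k t
  Truthful (φ U' ψ)   k (b , t , u) =
    (T b ⇔ Holds w k (φ U' ψ)) × Truthful φ k t × Truthful ψ k u

  ¬¬-truthful : ∀ φ k → ¬ ¬ Σ (Annotation φ) (Truthful φ k)
  ¬¬-truthful (atom _ _) k = pure (tt , tt)
  ¬¬-truthful (¬' φ)     k = ¬¬-truthful φ k
  ¬¬-truthful (φ ∨' ψ)   k = do
    (t , tt′) ← ¬¬-truthful φ k
    (u , tu) ← ¬¬-truthful ψ k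
    pure ((t , u) , tt′ , tu)
  ¬¬-truthful (X' φ)     k = do
    (t , tt′) ← ¬¬-truthful φ k
    (b , tb) ← ¬¬-truthValue
    pure ((b , t) , tb , tt′)
  ¬¬-truthful (φ U' ψ)   k = do
    (t , tt′) ← ¬¬-truthful φ k
    (u , tu) ← ¬¬-truthful ψ k
    (b , tb) ← ¬¬-truthValue
    pure ((b , t , u) , tb , tt′ , tu)

  value-truthful : ∀ φ {k t} → AtomsBelow M φ → Truthful φ k t → T (value φ (ℓ k) t) ⇔ Holds w k φ
  value-truthful (atom a v) {k} a<M _ =
    subst (λ b → T (ℓ k v a) ⇔ T b) (letter-snapshot (w k) v a<M) ⇔-refl
  value-truthful (¬' φ)     b tr = ⇔-trans T-not (¬-cong-⇔ (value-truthful φ b tr))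
  value-truthful (φ ∨' ψ)   (bφ , bψ) (tφ , tψ) =
    ⇔-trans T-∨ (value-truthful φ bφ tφ ⊎-⇔ value-truthful ψ bψ tψ)
  value-truthful (X' φ)     _ (tb , _) = tb
  value-truthful (φ U' ψ)   _ (tb , _) = tb

  consistent-truthful : ∀ φ {k t t′} → AtomsBelow M φ → Truthful φ k t → Truthful φ (suc k) t′ →
                        Consistent φ (ℓ k) t (ℓ (suc k)) t′
  consistent-truthful (atom _ _) _ _ _ = tt
  consistent-truthful (¬' φ)     b tr tr′ = consistent-truthful φ b tr tr′
  consistent-truthful (φ ∨' ψ)   (bφ , bψ) (tφ , tψ) (tφ′ , tψ′) =
    consistent-truthful φ bφ tφ tφ′ , consistent-truthful ψ bψ tψ tψ′
  consistent-truthful (X' φ)     b (tb , tφ) (_ , tφ′) =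
    T-⇔⇒≡ (⇔-trans tb (⇔-sym (value-truthful φ b tφ′))) , consistent-truthful φ b tφ tφ′
  consistent-truthful (φ U' ψ)   (bφ , bψ) (tb , tφ , tψ) (tb′ , tφ′ , tψ′) =
    T-⇔⇒≡ (⇔-trans tb (⇔-trans Until-unfold (⇔-sym unfolded))) ,
    consistent-truthful φ bφ tφ tφ′ , consistent-truthful ψ bψ tψ tψ′
    where
      unfolded =
        ⇔-trans T-∨ (value-truthful ψ bψ tψ ⊎-⇔ ⇔-trans T-∧ (value-truthful φ bφ tφ ×-⇔ tb′))

  Settled : QF (Fin 2) → QF (Fin 2) → ℕ → Set
  Settled φ ψ k = Holds w k ψ ⊎ ¬ Holds w k (φ U' ψ)

  SettledWithin : QF (Fin 2) → QF (Fin 2) → ℕ → ℕ → Set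
  SettledWithin φ ψ i j = ∃[ k ] (i ≤ k × k ≤ j × Settled φ ψ k)

  SettledWithin-mono : ∀ φ ψ {i} → UpwardClosed (SettledWithin φ ψ i)
  SettledWithin-mono φ ψ j≤j′ (k , i≤k , k≤j , s) = k , i≤k , ≤-trans k≤j j≤j′ , s

  Fulfilling : QF (Fin 2) → ℕ → ℕ → Set
  Fulfilling (atom _ _) i j = ⊤
  Fulfilling (¬' φ)     i j = Fulfilling φ i j
  Fulfilling (φ ∨' ψ)   i j = Fulfilling φ i j × Fulfilling ψ i j
  Fulfilling (X' φ)     i j = Fulfilling φ i j
  Fulfilling (φ U' ψ)   i j = SettledWithin φ ψ i j × Fulfilling φ i j × Fulfilling ψ i j

  Fulfilling-mono : ∀ φ {i j j′} → j ≤ j′ → Fulfilling φ i j → Fulfilling φ i j′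
  Fulfilling-mono (atom _ _) _ _ = tt
  Fulfilling-mono (¬' φ)     j≤j′ f = Fulfilling-mono φ j≤j′ f
  Fulfilling-mono (φ ∨' ψ)   j≤j′ (fφ , fψ) =
    Fulfilling-mono φ j≤j′ fφ , Fulfilling-mono ψ j≤j′ fψ
  Fulfilling-mono (X' φ)     j≤j′ f = Fulfilling-mono φ j≤j′ f
  Fulfilling-mono (φ U' ψ)   j≤j′ (s , fφ , fψ) =
    SettledWithin-mono φ ψ j≤j′ s , Fulfilling-mono φ j≤j′ fφ , Fulfilling-mono ψ j≤j′ fψ

  ¬¬-fulfilling : ∀ φ i → ¬ ¬ (∃[ j ] (i ≤ j × Fulfilling φ i j))
  ¬¬-fulfilling (atom _ _) i = pure (i , ≤-refl , tt)
  ¬¬-fulfilling (¬' φ)     i = ¬¬-fulfilling φ i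
  ¬¬-fulfilling (φ ∨' ψ)   i = do
    wφ ← ¬¬-fulfilling φ i
    wψ ← ¬¬-fulfilling ψ i
    pure (∃≥-× (Fulfilling-mono φ) (Fulfilling-mono ψ) wφ wψ)
  ¬¬-fulfilling (X' φ)     i = ¬¬-fulfilling φ i
  ¬¬-fulfilling (φ U' ψ)   i = do
    wφ ← ¬¬-fulfilling φ i
    wψ ← ¬¬-fulfilling ψ i
    U? ← ¬¬-excluded-middle
    pure (∃≥-× (SettledWithin-mono φ ψ) (Fulfilling-mono (φ ∨' ψ))
                (settle U?) (∃≥-× (Fulfilling-mono φ) (Fulfilling-mono ψ) wφ wψ))
    where
      settle : Dec (Holds w i (φ U' ψ)) → ∃[ j ] (i ≤ j × SettledWithin φ ψ i j)
      settle (yes (k , i≤k , holds , _)) = k , i≤k , k , i≤k , ≤-refl , inj₁ holds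
      settle (no ¬holds)                 = i , ≤-refl , i , ≤-refl , ≤-refl , inj₂ ¬holds

  fulfilling⇒eventualities :
    ∀ φ {τ : ℕ → Annotation φ} {a b} → AtomsBelow M φ →
    (∀ k → a ≤ k → k ≤ b → Truthful φ k (τ k)) → Fulfilling φ a b →
    All (λ q → ∃[ k ] (a ≤ k × k ≤ b × T (q (ℓ k) (τ k)))) (eventualities φ)
  fulfilling⇒eventualities (atom _ _) _ _ _ = []
  fulfilling⇒eventualities (¬' φ)     below tr f = fulfilling⇒eventualities φ below tr f
  fulfilling⇒eventualities (φ ∨' ψ)   (bφ , bψ) tr (fφ , fψ) =
    ++⁺ (map⁺ (fulfilling⇒eventualities φ bφ (λ k a≤k k≤b → proj₁ (tr k a≤k k≤b)) fφ))
        (map⁺ (fulfilling⇒eventualities ψ bψ (λ k a≤k k≤b → proj₂ (tr k a≤k k≤b)) fψ))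
  fulfilling⇒eventualities (X' φ)     below tr f =
    map⁺ (fulfilling⇒eventualities φ below (λ k a≤k k≤b → proj₂ (tr k a≤k k≤b)) f)
  fulfilling⇒eventualities (φ U' ψ)   (bφ , bψ) tr ((k , a≤k , k≤b , settled) , fφ , fψ) =
    (k , a≤k , k≤b , from fulfilled settled) ∷
    ++⁺ (map⁺ (fulfilling⇒eventualities φ bφ (λ k a≤k k≤b → proj₁ (proj₂ (tr k a≤k k≤b))) fφ))
        (map⁺ (fulfilling⇒eventualities ψ bψ (λ k a≤k k≤b → proj₂ (proj₂ (tr k a≤k k≤b))) fψ))
    where
      fulfilled = ⇔-trans T-∨ (value-truthful ψ bψ (proj₂ (proj₂ (tr k a≤k k≤b))) ⊎-⇔
                               ⇔-trans T-not (¬-cong-⇔ (proj₁ (tr k a≤k k≤b))))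

  module _ (ψ : QF (Fin 2)) (below : AtomsBelow M ψ) where

    open Tableau ψ M

    vertex : (ℕ → Annotation ψ) → ℕ → Vertex
    vertex τ k = snapshot M (w k) , τ k

    fairLasso : ∀ τ {a b} → a < b → vertex τ a ≡ vertex τ b →
                (∀ k → k ≤ b → Truthful ψ k (τ k)) → Fulfilling ψ a b →
                StartTogether w → Holds w 0 ψ → FairLasso
    fairLasso τ {a} {b} a<b loops truthful fulfilling start holds =
      vertex τ 0 , vertex τ a ,
      (prefix-cong M start , from (value-truthful ψ below (truthful 0 z≤n)) holds) ,
      Star⇒Reach (walk z≤n (<⇒≤ a<b)) ,
      (vertex τ (suc a) , step a a<b , Star⇒Reach (back a<b)) ,
      All.map (λ (k , a≤k , k≤b , fk) →
                 vertex τ k , fk , Star⇒Reach (walk a≤k k≤b) , Star⇒Reach (back k≤b))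
              (fulfilling⇒eventualities ψ below (λ k _ k≤b → truthful k k≤b) fulfilling)
      where
        step : ∀ k → k < b → Step (vertex τ k) (vertex τ (suc k))
        step k k<b = consistent-truthful ψ below (truthful k (<⇒≤ k<b)) (truthful (suc k) k<b)
        walk : ∀ {i j} → i ≤ j → j ≤ b → Star Step (vertex τ i) (vertex τ j)
        walk = Star-sequence (vertex τ) step
        back : ∀ {k} → k ≤ b → Star Step (vertex τ k) (vertex τ a)
        back {k} k≤b = subst (Star Step (vertex τ k)) (sym loops) (walk k≤b ≤-refl)

    N : ℕ
    N = proj₁ Finite-Vertex

    -- Two of the N + 1 chain points carry the same vertex, and the window after the first is fulfilling.
    chain⇒fairLasso : ∀ {p τ} → Chain (Fulfilling ψ) N p → (∀ k → k ≤ p N → Truthful ψ k (τ k)) →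
                      StartTogether w → Holds w 0 ψ → FairLasso
    chain⇒fairLasso {p} {τ} chain truthful start holds
      with pigeonhole (n<1+n N) (encode Finite-Vertex ∘ vertex τ ∘ p ∘ toℕ)
    ... | i , j , i<j , same =
      fairLasso τ (Chain-< {Fulfilling ψ} chain i<j j≤N) (encode-injective Finite-Vertex same)
                (λ k k≤b → truthful k (≤-trans k≤b (Chain-≤ {Fulfilling ψ} chain j≤N ≤-refl)))
                (Fulfilling-mono ψ (Chain-≤ {Fulfilling ψ} chain i<j j≤N) window)
                start holds
      where
        j≤N : toℕ j ≤ N
        j≤N = ≤-pred (toℕ<n j)
        window : Fulfilling ψ (p (toℕ i)) (p (suc (toℕ i)))
        window = proj₂ (chain _ (<-≤-trans i<j j≤N))

    ¬¬-fairLasso : StartTogether w → Holds w 0 ψ → ¬ ¬ FairLasso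
    ¬¬-fairLasso start holds = do
      (p , _ , chain) ← ¬¬-chain (Fulfilling-mono ψ) (¬¬-fulfilling ψ) N 0
      (τ , truthful) ← ¬¬-bounded-choice (¬¬-truthful ψ) (p N)
      pure (chain⇒fairLasso chain truthful start holds)

twoTraceModel⇒¬¬fairLasso : ∀ ψ → TwoTraceModel ψ → ¬ ¬ Tableau.FairLasso ψ (atomBound ψ)
twoTraceModel⇒¬¬fairLasso ψ (w , start , holds) =
  Completeness.¬¬-fairLasso w (atomBound ψ) ψ (AtomsBelow-atomBound ψ) start holds

corollary1 : (ψ'' ψ' : QF (Fin 2)) → Dec (Satisfiable (fragment ψ'' ψ'))
corollary1 ψ'' ψ' =
  map′ (twoTraceModel⇒satisfiable ψ'' ψ' ∘ fairLasso⇒twoTraceModel)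
       (decidable-stable fairLasso? ∘ twoTraceModel⇒¬¬fairLasso ψ' ∘
        satisfiable⇒twoTraceModel ψ'' ψ')
       fairLasso?
  where open Tableau ψ' (atomBound ψ')
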